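{- Let $i$ be an intuitionistic propositional formula, $\varphi(x)=ST(i,x)$ and $k=r(\varphi)$. Then $\varphi(x)$ is invariant with respect to $k$-asimulations.
   Context: Formulas are formulas of classical first-order logic with identity in the vocabulary $\Sigma=\{R,P_1,P_2,\dots\}$, $R$ binary, each $P_n$ unary; $\Sigma_\varphi=\{R\}\cup\{P_i: P_i\text{ occurs in }\varphi\}$. The degree $r(\varphi)$ is the quantifier depth: $r=0$ for atomic, $r(\neg\varphi)=r(\varphi)$, $r(\varphi\circ\psi)=\max(r(\varphi),r(\psi))$, $r(Qx\varphi)=r(\varphi)+1$. A pointed model is $(M,a)$ with $a\in D(M)$; $M,a\models\varphi(x)$ means $\varphi$ holds in $M$ under assignments sending $x$ to $a$. Intuitionistic propositional formulas are built from $p_n$, $\bot$ with $\wedge,\vee,\to$. Standard $x$-translation: $ST(p_n,x)=P_n(x)$; $ST(\bot,x)=(x\neq x)$; $ST(i\wedge j,x)=ST(i,x)\wedge ST(j,x)$; $ST(i\vee j,x)=ST(i,x)\vee ST(j,x)$; $ST(i\to j,x)=\forall y(R(x,y)\to(ST(i,y)\to ST(j,y)))$, $y$ fresh. $k$-asimulation: for $R\in\Sigma'\subseteq\Sigma$ and pointed $\Sigma'$-models $(M,a),(N,b)$, a relation $A\subseteq\bigcup_{n>0}((D(M)^n\times D(N)^n)\cup(D(N)^n\times D(M)^n))$ is an $\langle(M,a),(N,b)\rangle_k$-asimulation iff $(a)A(b)$ and for all $\alpha,\beta\in\{M,N\}$, $(a'_1,\dots,a'_m,a')\in D(\alpha)^{m+1}$,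 $(b'_1,\dots,b'_m,b')\in D(\beta)^{m+1}$ with $(a'_1,\dots,a'_m,a')A(b'_1,\dots,b'_m,b')$: (1) for every unary $P\in\Sigma'$, $\alpha,a'\models P(x)$ implies $\beta,b'\models P(x)$; (2) if $b''\in D(\beta)$, $b'R^\beta b''$ and $m<k$, then some $a''\in D(\alpha)$ has $a'R^\alpha a''$, $(b'_1,\dots,b'_m,b',b'')A(a'_1,\dots,a'_m,a',a'')$ and $(a'_1,\dots,a'_m,a',a'')A(b'_1,\dots,b'_m,b',b'')$. $\varphi(x)$ is invariant with respect to $k$-asimulations iff for every $\Sigma'$ with $\Sigma_\varphi\subseteq\Sigma'\subseteq\Sigma$ and all pointed $\Sigma'$-models $(M,a),(N,b)$, if an $\langle(M,a),(N,b)\rangle_k$-asimulation exists and $M,a\models\varphi(x)$, then $N,b\models\varphi(x)$. -}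

module Defs where

open import Data.Nat using (ℕ; zero; suc; _<_; _⊔_; _≡ᵇ_)
open import Data.Bool using (if_then_else_)
open import Data.Empty using (⊥)
open import Data.Sum using (_⊎_; inj₁; inj₂)
open import Data.Product using (Σ; _×_; ∃-syntax)
open import Data.Vec using (Vec; []; _∷_; _∷ʳ_)
open import Relation.Nullary using (¬_)
open import Relation.Binary.PropositionalEquality using (_≡_; refl)

Var : Set
Var = ℕ

data Fm : Set where
  rel : Var → Var → Fm
  pr  : ℕ → Var → Fm
  eq  : Var → Var → Fm
  neg : Fm → Fm
  and : Fm → Fm → Fm
  or  : Fm → Fm → Fm
  imp : Fm → Fm → Fm
  all : Var → Fm → Fm
  ex  : Var → Fm → Fm

r : Fm → ℕ
r (rel x y) = 0
r (pr n x)  = 0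
r (eq x y)  = 0
r (neg φ)   = r φ
r (and φ ψ) = r φ ⊔ r ψ
r (or φ ψ)  = r φ ⊔ r ψ
r (imp φ ψ) = r φ ⊔ r ψ
r (all x φ) = suc (r φ)
r (ex x φ)  = suc (r φ)

-- Occ n φ : the unary predicate P_n occurs in φ
-- (so Σ_φ = {R} ∪ {P_n : Occ n φ}).
Occ : ℕ → Fm → Set
Occ n (rel x y) = ⊥
Occ n (pr m x)  = n ≡ m
Occ n (eq x y)  = ⊥
Occ n (neg φ)   = Occ n φ
Occ n (and φ ψ) = Occ n φ ⊎ Occ n ψ
Occ n (or φ ψ)  = Occ n φ ⊎ Occ n ψ
Occ n (imp φ ψ) = Occ n φ ⊎ Occ n ψ
Occ n (all x φ) = Occ n φ
Occ n (ex x φ)  = Occ n φ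

-- Sub-vocabularies Σ' ⊆ Σ containing R: given by the set S of indices n
-- with P_n ∈ Σ'.  A Σ'-model interprets R and exactly the P_n with n ∈ S.

Sig : Set₁
Sig = ℕ → Set

record Model (S : Sig) : Set₁ where
  field
    D : Set
    R : D → D → Set
    P : (n : ℕ) → S n → D → Set

open Model public

_⊆Sig_ : Fm → Sig → Set
φ ⊆Sig S = (n : ℕ) → Occ n φ → S n

_[_↦_] : {D : Set} → (Var → D) → Var → D → (Var → D)
(g [ x ↦ d ]) y = if y ≡ᵇ x then d else g y

Sat : {S : Sig} (M : Model S) (φ : Fm) → φ ⊆Sig S → (Var → D M) → Set
Sat M (rel x y) w g = R M (g x) (g y)
Sat M (pr n x)  w g = P M n (w n refl) (g x)
Sat M (eq x y)  w g = g x ≡ g y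
Sat M (neg φ)   w g = ¬ Sat M φ w g
Sat M (and φ ψ) w g = Sat M φ (λ n o → w n (inj₁ o)) g × Sat M ψ (λ n o → w n (inj₂ o)) g
Sat M (or φ ψ)  w g = Sat M φ (λ n o → w n (inj₁ o)) g ⊎ Sat M ψ (λ n o → w n (inj₂ o)) g
Sat M (imp φ ψ) w g = Sat M φ (λ n o → w n (inj₁ o)) g → Sat M ψ (λ n o → w n (inj₂ o)) g
Sat M (all x φ) w g = (d : D M) → Sat M φ w (g [ x ↦ d ])
Sat M (ex x φ)  w g = Σ (D M) (λ d → Sat M φ w (g [ x ↦ d ]))

PSat : {S : Sig} (M : Model S) (φ : Fm) → φ ⊆Sig S → Var → D M → Set
PSat M φ w x a = (g : Var → D M) → g x ≡ a → Sat M φ w g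

data IFm : Set where
  var : ℕ → IFm
  bot : IFm
  _∧ᵢ_ : IFm → IFm → IFm
  _∨ᵢ_ : IFm → IFm → IFm
  _⇒ᵢ_ : IFm → IFm → IFm

-- ST(i , x); for implications the bound variable y is suc x, which is
-- fresh (distinct from x, the only free variable of ST(i , x)).
ST : IFm → Var → Fm
ST (var n)  x = pr n x
ST bot      x = neg (eq x x)
ST (i ∧ᵢ j) x = and (ST i x) (ST j x)
ST (i ∨ᵢ j) x = or (ST i x) (ST j x)
ST (i ⇒ᵢ j) x = all (suc x) (imp (rel x (suc x)) (imp (ST i (suc x)) (ST j (suc x))))

-- An asimulation A is given by its two components
--   A₁ ⊆ ⋃ₙ D(M)^n × D(N)^n   and   A₂ ⊆ ⋃ₙ D(N)^n × D(M)^n   (n = suc m > 0);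
-- A is their union.

TRel : Set → Set → Set₁
TRel X Y = (m : ℕ) → Vec X (suc m) → Vec Y (suc m) → Set

record Cond {S : Sig} (α β : Model S) (k : ℕ)
            (A₁ : TRel (D α) (D β)) (A₂ : TRel (D β) (D α)) : Set where
  field
    atom : (m : ℕ) (as : Vec (D α) m) (a′ : D α) (bs : Vec (D β) m) (b′ : D β) →
           A₁ m (as ∷ʳ a′) (bs ∷ʳ b′) →
           (n : ℕ) (p : S n) → P α n p a′ → P β n p b′
    back : (m : ℕ) (as : Vec (D α) m) (a′ : D α) (bs : Vec (D β) m) (b′ : D β) →
           A₁ m (as ∷ʳ a′) (bs ∷ʳ b′) →
           (b″ : D β) → R β b′ b″ → m < k →
           ∃[ a″ ] ( R α a′ a″
                   × A₂ (suc m) ((bs ∷ʳ b′) ∷ʳ b″) ((as ∷ʳ a′) ∷ʳ a″)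
                   × A₁ (suc m) ((as ∷ʳ a′) ∷ʳ a″) ((bs ∷ʳ b′) ∷ʳ b″) )

record IsAsim {S : Sig} (M N : Model S) (a : D M) (b : D N) (k : ℕ)
              (A₁ : TRel (D M) (D N)) (A₂ : TRel (D N) (D M)) : Set where
  field
    base : A₁ 0 (a ∷ []) (b ∷ [])
    condMN : Cond M N k A₁ A₂
    condNM : Cond N M k A₂ A₁

Asim : {S : Sig} (M N : Model S) (a : D M) (b : D N) (k : ℕ) → Set₁
Asim M N a b k = ∃[ A₁ ] ∃[ A₂ ] IsAsim M N a b k A₁ A₂

Invariant : Fm → Var → ℕ → Set₁
Invariant φ x k =
  (S : Sig) (w : φ ⊆Sig S) (M N : Model S) (a : D M) (b : D N) →
  Asim M N a b k → PSat M φ w x a → PSat N φ w x b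

-- ST(i, x) quantifies only in the guarded form ∀y (R(x, y) → …), one guard per
-- nested implication of i.  Induction on i transfers truth from a′ to b′
-- whenever (…, a′) A (…, b′) for tuples of length m + 1 with m + depth i ≤ k,
-- so that condition (2) is still available: the implication case answers an
-- R-successor b″ of b′ by condition (2), which yields a″ related to b″ in BOTH
-- directions; the antecedent is carried back from b″ to a″ and the consequent
-- forward from a″ to b″.
module Submission where

open import Defs
open import Data.Nat using (ℕ; zero; suc; _+_; _≤_; _<_; _⊔_; _≡ᵇ_; s≤s)
open import Data.Nat.Properties using (m≤m⊔n; m≤n⊔m; m≤m+n; +-monoʳ-≤; +-suc; ≤-trans; ≤-reflexive)
open import Data.Bool using (true; false)
open import Data.Sum using (inj₁; inj₂)
open import Data.Product using (_,_)
open import Data.Vec using (Vec; []; _∷_; _∷ʳ_)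
open import Relation.Binary.PropositionalEquality using (_≡_; refl; sym; trans; subst; subst₂)

depth : IFm → ℕ
depth (var n)  = 0
depth bot      = 0
depth (i ∧ᵢ j) = depth i ⊔ depth j
depth (i ∨ᵢ j) = depth i ⊔ depth j
depth (i ⇒ᵢ j) = suc (depth i ⊔ depth j)

r-ST : (i : IFm) (x : Var) → r (ST i x) ≡ depth i
r-ST (var n)  x = refl
r-ST bot      x = refl
r-ST (i ∧ᵢ j) x rewrite r-ST i x | r-ST j x = refl
r-ST (i ∨ᵢ j) x rewrite r-ST i x | r-ST j x = refl
r-ST (i ⇒ᵢ j) x rewrite r-ST i (suc x) | r-ST j (suc x) = refl

≡ᵇ-refl : (n : ℕ) → (n ≡ᵇ n) ≡ true
≡ᵇ-refl zero    = refl
≡ᵇ-refl (suc n) = ≡ᵇ-refl n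

n≡ᵇ1+n : (n : ℕ) → (n ≡ᵇ suc n) ≡ false
n≡ᵇ1+n zero    = refl
n≡ᵇ1+n (suc n) = n≡ᵇ1+n n

[↦]-same : {D : Set} (g : Var → D) (y : Var) (d : D) → (g [ y ↦ d ]) y ≡ d
[↦]-same g y d rewrite ≡ᵇ-refl y = refl

[↦]-fresh : {D : Set} (g : Var → D) (y : Var) (d : D) → (g [ suc y ↦ d ]) y ≡ g y
[↦]-fresh g y d rewrite n≡ᵇ1+n y = refl

m+n⊔o≤p⇒m+n≤p : ∀ m n o {p} → m + (n ⊔ o) ≤ p → m + n ≤ p
m+n⊔o≤p⇒m+n≤p m n o = ≤-trans (+-monoʳ-≤ m (m≤m⊔n n o))

m+n⊔o≤p⇒m+o≤p : ∀ m n o {p} → m + (n ⊔ o) ≤ p → m + o ≤ p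
m+n⊔o≤p⇒m+o≤p m n o = ≤-trans (+-monoʳ-≤ m (m≤n⊔m n o))

m+1+n≤o⇒1+m+n≤o : ∀ m n {o} → m + suc n ≤ o → suc m + n ≤ o
m+1+n≤o⇒1+m+n≤o m n {o} = subst (_≤ o) (+-suc m n)

m+1+n≤o⇒m<o : ∀ m n {o} → m + suc n ≤ o → m < o
m+1+n≤o⇒m<o m n le = ≤-trans (s≤s (m≤m+n m n)) (m+1+n≤o⇒1+m+n≤o m n le)

ST-transfer : ∀ {S : Sig} {α β : Model S} {k A₁ A₂} →
  Cond α β k A₁ A₂ → Cond β α k A₂ A₁ →
  (i : IFm) (y : Var) (w : ST i y ⊆Sig S) {m : ℕ}
  (as : Vec (D α) m) (a′ : D α) (bs : Vec (D β) m) (b′ : D β) →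
  A₁ m (as ∷ʳ a′) (bs ∷ʳ b′) → m + depth i ≤ k →
  {g : Var → D α} {h : Var → D β} → g y ≡ a′ → h y ≡ b′ →
  Sat α (ST i y) w g → Sat β (ST i y) w h
ST-transfer {α = α} {β} c₁ c₂ (var n) y w as a′ bs b′ A le gy hy s =
  subst (P β n (w n refl)) (sym hy)
    (Cond.atom c₁ _ as a′ bs b′ A n (w n refl) (subst (P α n (w n refl)) gy s))
ST-transfer c₁ c₂ bot y w as a′ bs b′ A le gy hy s = λ _ → s refl
ST-transfer c₁ c₂ (i ∧ᵢ j) y w as a′ bs b′ A le gy hy (sᵢ , sⱼ) =
  ST-transfer c₁ c₂ i y _ as a′ bs b′ A (m+n⊔o≤p⇒m+n≤p _ (depth i) (depth j) le) gy hy sᵢ ,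
  ST-transfer c₁ c₂ j y _ as a′ bs b′ A (m+n⊔o≤p⇒m+o≤p _ (depth i) (depth j) le) gy hy sⱼ
ST-transfer c₁ c₂ (i ∨ᵢ j) y w as a′ bs b′ A le gy hy (inj₁ sᵢ) =
  inj₁ (ST-transfer c₁ c₂ i y _ as a′ bs b′ A (m+n⊔o≤p⇒m+n≤p _ (depth i) (depth j) le) gy hy sᵢ)
ST-transfer c₁ c₂ (i ∨ᵢ j) y w as a′ bs b′ A le gy hy (inj₂ sⱼ) =
  inj₂ (ST-transfer c₁ c₂ j y _ as a′ bs b′ A (m+n⊔o≤p⇒m+o≤p _ (depth i) (depth j) le) gy hy sⱼ)
ST-transfer {α = α} {β} {k} c₁ c₂ (i ⇒ᵢ j) y w {m} as a′ bs b′ A le {g} {h} gy hy s b″ h′b′b″ h′⊨i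
  with Cond.back c₁ m as a′ bs b′ A b″
         (subst₂ (R β) (trans ([↦]-fresh h y b″) hy) ([↦]-same h (suc y) b″) h′b′b″)
         (m+1+n≤o⇒m<o m (depth i ⊔ depth j) le)
... | a″ , a′Ra″ , A-back , A-forth = ST-transfer c₁ c₂ j (suc y) _ _ a″ _ b″ A-forth
        (m+n⊔o≤p⇒m+o≤p (suc m) (depth i) (depth j) le′) g′y′ h′y′ (s a″ g′a′a″ g′⊨i)
  where
  le′ : suc m + (depth i ⊔ depth j) ≤ k
  le′ = m+1+n≤o⇒1+m+n≤o m (depth i ⊔ depth j) le
  g′y′ : (g [ suc y ↦ a″ ]) (suc y) ≡ a″
  g′y′ = [↦]-same g (suc y) a″
  h′y′ : (h [ suc y ↦ b″ ]) (suc y) ≡ b″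
  h′y′ = [↦]-same h (suc y) b″
  g′a′a″ : R α ((g [ suc y ↦ a″ ]) y) ((g [ suc y ↦ a″ ]) (suc y))
  g′a′a″ = subst₂ (R α) (sym (trans ([↦]-fresh g y a″) gy)) (sym g′y′) a′Ra″
  g′⊨i : Sat α (ST i (suc y)) _ (g [ suc y ↦ a″ ])
  g′⊨i = ST-transfer c₂ c₁ i (suc y) _ _ b″ _ a″ A-back
           (m+n⊔o≤p⇒m+n≤p (suc m) (depth i) (depth j) le′) h′y′ g′y′ h′⊨i

corollary1 : (i : IFm) (x : Var) → Invariant (ST i x) x (r (ST i x))
corollary1 i x S w M N a b (A₁ , A₂ , isAsim) M,a⊨φ h hx =
  ST-transfer (IsAsim.condMN isAsim) (IsAsim.condNM isAsim) i x w [] a [] b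
    (IsAsim.base isAsim) (≤-reflexive (sym (r-ST i x))) refl hx
    (M,a⊨φ (λ _ → a) refl)
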